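{- Let $(S,\bullet)$ be a partial semigroup and assume there is a minimal left ideal $L$ of $S$ which contains an idempotent $e$. Then $e\bullet L$ is a partial group.
   Context: A partial semigroup is a nonempty set $S$ with a partially defined operation $\bullet$ such that $(x\bullet y)\bullet z=x\bullet(y\bullet z)$ in the sense that if either side is defined so is the other and they are equal. $L(x)=\{s:s\bullet x\text{ defined}\}$. A left ideal is a nonempty $I\subseteq S$ with $y\bullet x\in I$ whenever $x\in I$ and $y\in L(x)$; minimal if it contains no other left ideal. $e$ is idempotent if $e\bullet e=e$. $e\bullet L=\{e\bullet x:x\in L,\ e\bullet x\text{ defined}\}$, with the restricted operation. A partial semigroup $G$ is a partial group if there is an idempotent $e\in G$ with $e\bullet s$ defined and equal to $s$ for all $s\in G$, and for every $x\in G$ there is $y\in G$ with $y\bullet x$ defined and equal to $e$. -}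

module Defs where

open import Level using (Level; _⊔_; suc)
open import Data.Maybe using (Maybe; just; nothing; _>>=_)
open import Data.Product using (Σ; ∃; _×_; _,_)
open import Relation.Binary.PropositionalEquality using (_≡_)

-- Associativity in the strong sense:
-- (x•y)•z is defined iff x•(y•z) is, and then they are equal; this is exactly
-- equality of the two Maybe-values obtained by Kleisli composition.
record PartialSemigroup (ℓ : Level) : Set (suc ℓ) where
  field
    Carrier  : Set ℓ
    _•_      : Carrier → Carrier → Maybe Carrier
    inhabited : Carrier
    assoc    : ∀ x y z → ((x • y) >>= λ w → w • z) ≡ ((y • z) >>= λ w → x • w)

module _ {ℓ : Level} (S : PartialSemigroup ℓ) where
  open PartialSemigroup S

  Subset : Set (suc ℓ)
  Subset = Carrier → Set ℓ

  _⊆_ : Subset → Subset → Set ℓ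
  I ⊆ J = ∀ x → I x → J x

  Lft : Carrier → Subset
  Lft x s = ∃ λ z → s • x ≡ just z

  IsIdempotent : Carrier → Set ℓ
  IsIdempotent e = e • e ≡ just e

  record IsLeftIdeal (I : Subset) : Set ℓ where
    field
      nonempty : ∃ λ x → I x
      closed   : ∀ x y z → I x → y • x ≡ just z → I z

  record IsMinimalLeftIdeal (L : Subset) : Set (suc ℓ) where
    field
      isLeftIdeal : IsLeftIdeal L
      minimal     : (J : Subset) → IsLeftIdeal J → J ⊆ L → L ⊆ J

  _•ˢ_ : Carrier → Subset → Subset
  (e •ˢ L) s = ∃ λ x → L x × e • x ≡ just s

  -- G ⊆ S, equipped with the restriction of •, is a partial group.
  -- `closed` says the restricted operation takes values in G, so that G with
  -- the restricted operation is a partial semigroup (associativity and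
  -- nonemptiness being inherited / recorded); the remaining fields are the
  -- partial-group axioms read inside G.
  record IsPartialGroupOn (G : Subset) : Set ℓ where
    field
      nonempty : ∃ λ x → G x
      closed   : ∀ x y z → G x → G y → x • y ≡ just z → G z
      identity : Σ Carrier λ f → G f × IsIdempotent f ×
                   (∀ s → G s → f • s ≡ just s) ×
                   (∀ x → G x → Σ Carrier λ y → G y × y • x ≡ just f)

{-# OPTIONS --safe #-}
module Submission where

-- Idempotency of e makes it a left identity on e • L, and e • L is closed
-- because L is a left ideal containing it.  For inverses, given x ∈ e • L
-- the set L • x is a left ideal inside L, so by minimality it is L itself;
-- hence t • x = e for some t ∈ L, and reassociating e • (t • x) = e • e = e
-- gives (e • t) • x = e with e • t ∈ e • L.

open import Level using (Level)
open import Data.Maybe using (Maybe; just; _>>=_)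
open import Data.Product using (Σ; ∃; _×_; _,_)
open import Relation.Binary.PropositionalEquality using (_≡_; refl; sym; trans; cong)
open import Defs
open PartialSemigroup using (Carrier)

>>=-≡-just : ∀ {a} {A B : Set a} (m : Maybe A) {f : A → Maybe B} {v : B} →
             (m >>= f) ≡ just v → ∃ λ u → m ≡ just u × f u ≡ just v
>>=-≡-just (just u) eq = u , refl , eq

module _ {ℓ : Level} (S : PartialSemigroup ℓ) where
  open PartialSemigroup S using (_•_) renaming (assoc to •-assoc)

  reassocʳ : ∀ {x y z w v} → x • y ≡ just w → w • z ≡ just v →
             ∃ λ u → y • z ≡ just u × x • u ≡ just v
  reassocʳ {x} {y} {z} xy≡w wz≡v =
    >>=-≡-just (y • z) (trans (sym (•-assoc x y z)) (trans (cong (_>>= λ w → w • z) xy≡w) wz≡v))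

  reassocˡ : ∀ {x y z u v} → y • z ≡ just u → x • u ≡ just v →
             ∃ λ w → x • y ≡ just w × w • z ≡ just v
  reassocˡ {x} {y} {z} yz≡u xu≡v =
    >>=-≡-just (x • y) (trans (•-assoc x y z) (trans (cong (_>>= x •_) yz≡u) xu≡v))

  idempotent-identityˡ : ∀ {e} (I : Subset S) → IsIdempotent S e →
                         ∀ s → (_•ˢ_ S e I) s → e • s ≡ just s
  idempotent-identityˡ I ee≡e s (a , _ , ea≡s) with reassocʳ ee≡e ea≡s
  ... | u , ea≡u , eu≡s with trans (sym ea≡s) ea≡u
  ... | refl = eu≡s

  _•ᵣ_ : Subset S → Carrier S → Subset S
  (I •ᵣ x) s = ∃ λ t → I t × t • x ≡ just s

  module _ {I : Subset S} (ideal : IsLeftIdeal S I) where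
    open IsLeftIdeal ideal using (closed)

    •ˢ-⊆ : ∀ e → _⊆_ S (_•ˢ_ S e I) I
    •ˢ-⊆ e s (a , Ia , ea≡s) = closed a e s Ia ea≡s

    •ˢ-closedʳ : ∀ e x y z → (_•ˢ_ S e I) x → I y → x • y ≡ just z → (_•ˢ_ S e I) z
    •ˢ-closedʳ e x y z (a , _ , ea≡x) Iy xy≡z with reassocʳ ea≡x xy≡z
    ... | w , ay≡w , ew≡z = w , closed y a w Iy ay≡w , ew≡z

    •ᵣ-isLeftIdeal : ∀ {x t y} → I t → t • x ≡ just y → IsLeftIdeal S (I •ᵣ x)
    •ᵣ-isLeftIdeal {x} {t} {y} It tx≡y = record
      { nonempty = y , t , It , tx≡y
      ; closed   = λ { s r z (u , Iu , ux≡s) rs≡z →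
                        let (w , ru≡w , wx≡z) = reassocˡ ux≡s rs≡z
                        in w , closed u r w Iu ru≡w , wx≡z } }

    •ᵣ-⊆ : ∀ {x} → I x → _⊆_ S (I •ᵣ x) I
    •ᵣ-⊆ {x} Ix s (t , _ , tx≡s) = closed x t s Ix tx≡s

  minimal-left-divisible : ∀ {L x t y z} → IsMinimalLeftIdeal S L →
                           L x → L t → t • x ≡ just y → L z →
                           ∃ λ s → L s × s • x ≡ just z
  minimal-left-divisible {L} {x} {z = z} min Lx Lt tx≡y Lz =
    minimal (L •ᵣ x) (•ᵣ-isLeftIdeal isLeftIdeal Lt tx≡y) (•ᵣ-⊆ isLeftIdeal Lx) z Lz
    where open IsMinimalLeftIdeal min

theorem2p12 : {ℓ : Level} (S : PartialSemigroup ℓ) (L : Subset S) (e : Carrier S) →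
              IsMinimalLeftIdeal S L → L e → IsIdempotent S e →
              IsPartialGroupOn S (_•ˢ_ S e L)
theorem2p12 S L e min Le ee≡e = record
  { nonempty = e , eLe
  ; closed   = λ x y z eLx eLy → •ˢ-closedʳ S ideal e x y z eLx (•ˢ-⊆ S ideal e y eLy)
  ; identity = e , eLe , ee≡e , identityˡ , inverse
  }
  where
  open PartialSemigroup S using (_•_)
  ideal : IsLeftIdeal S L
  ideal = IsMinimalLeftIdeal.isLeftIdeal min
  eLe : (_•ˢ_ S e L) e
  eLe = e , Le , ee≡e
  identityˡ : ∀ s → (_•ˢ_ S e L) s → e • s ≡ just s
  identityˡ = idempotent-identityˡ S L ee≡e
  inverse : ∀ x → (_•ˢ_ S e L) x → Σ (Carrier S) λ y → (_•ˢ_ S e L) y × y • x ≡ just e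
  inverse x eLx with minimal-left-divisible S min (•ˢ-⊆ S ideal e x eLx) Le (identityˡ x eLx) Le
  ... | t , Lt , tx≡e with reassocˡ S tx≡e ee≡e
  ... | y , et≡y , yx≡e = y , (t , Lt , et≡y) , yx≡e
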